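{- For every $n \in \mathbb{N}$, $$\prod_{p \text{ prime}} p^{\left\lfloor \frac{n}{p-1} \right\rfloor} = \mathrm{lcm}\Big\{ i_1 i_2 \cdots i_n \;;\; i_1, \dots, i_n \in \mathbb{N}^*,\ i_1 + i_2 + \dots + i_n \le 2n \Big\}.$$
   Context: $\mathbb{N} = \{0,1,2,\dots\}$, $\mathbb{N}^* = \{1,2,\dots\}$; for $n=0$ the set consists of the empty product $1$. $\lfloor\cdot\rfloor$ is the floor function. -}

module Defs where

open import Data.Nat using (ℕ; zero; suc; _*_; _^_; _/_)
open import Data.Nat.Divisibility using (_∣_)
open import Data.Nat.Primality using (prime?)
open import Data.Product using (_×_)
open import Data.Vec using (Vec; foldr)
open import Relation.Nullary using (yes; no)

-- Exponent ⌊ n / (p - 1) ⌋, for p ≥ 2 (only used at primes p; value at p < 2 irrelevant).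
expo : ℕ → ℕ → ℕ
expo n zero = 0
expo n (suc zero) = 0
expo n (suc (suc k)) = n / suc k

primeFactor : ℕ → ℕ → ℕ
primeFactor n p with prime? p
... | yes _ = p ^ expo n p
... | no _  = 1

-- ∏_{p prime, p ≤ N} p ^ ⌊ n / (p - 1) ⌋   (truncation of the product over all primes)
primeProdUpTo : ℕ → ℕ → ℕ
primeProdUpTo n zero = 1
primeProdUpTo n (suc N) = primeFactor n (suc N) * primeProdUpTo n N

IsLCMOf : (ℕ → Set) → ℕ → Set
IsLCMOf S m = (∀ x → S x → x ∣ m) × (∀ c → (∀ x → S x → x ∣ c) → m ∣ c)

vprod : ∀ {n} → Vec ℕ n → ℕ
vprod = foldr _ _*_ 1

-- Write D n N for the product over primes p ≤ N of p ^ ⌊n/(p-1)⌋.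
-- Every product i₁⋯iₙ with Σ iⱼ ≤ 2n divides D n N: the exponent map n ↦ ⌊n/(p-1)⌋ is
-- superadditive, so D is supermultiplicative in n; a prime p ≤ N divides D (p-1) N, and since
-- (a-1) + (b-1) ≤ ab-1 this extends to x ∣ D (x-1) N for every 1 ≤ x ≤ N; finally
-- Σ (iⱼ - 1) = Σ iⱼ - n ≤ n. Conversely p ^ ⌊n/(p-1)⌋ is itself such a product (take
-- ⌊n/(p-1)⌋ factors p and pad with ones), and these prime powers are pairwise coprime, so
-- their product divides every common multiple.
module Submission where

open import Defs
open import Data.Nat using (ℕ; _+_; _*_; _≤_)
open import Data.Vec using (Vec; sum)
open import Data.Vec.Relation.Unary.All using (All)
open import Data.Product using (∃; _×_)
open import Relation.Binary.PropositionalEquality using (_≡_)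

open import Data.Nat using (zero; suc; pred; _∸_; _^_; _<_; _/_; NonZero; z≤n; s≤s; s≤s⁻¹; nonTrivial⇒n>1)
open import Data.Nat.Properties
open import Data.Nat.Divisibility
open import Data.Nat.DivMod using (m*n/n≡m; m/n*n≤m; m/n≤m; /-monoˡ-≤; n/n≡1)
open import Data.Nat.Coprimality as Coprimality using (Coprime; coprime-divisor; prime⇒coprime)
open import Data.Nat.Primality using (Prime; prime?; prime⇒nonTrivial; prime⇒nonZero; productOfPrimes≢0)
open import Data.Nat.Primality.Factorisation using (PrimeFactorisation; factorise)
open import Data.Nat.ListAction using (product)
open import Algebra.Properties.CommutativeSemigroup +-commutativeSemigroup using (x∙yz≈y∙xz)
open import Algebra.Properties.CommutativeSemigroup *-commutativeSemigroup using (interchange)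
open import Data.List using (List)
import Data.List.Relation.Unary.All as List
open import Data.Vec using ([]; _∷_; map)
open import Data.Product using (_,_)
open import Relation.Nullary using (yes; no; contradiction)
open import Relation.Binary.PropositionalEquality using (refl; sym; trans; cong; subst; module ≡-Reasoning)

open All

D : ℕ → ℕ → ℕ
D = primeProdUpTo

prime⇒2≤ : ∀ {p} → Prime p → 2 ≤ p
prime⇒2≤ {p} pr = nonTrivial⇒n>1 p {{prime⇒nonTrivial pr}}

^-monoʳ-∣ : ∀ p {m n} → m ≤ n → p ^ m ∣ p ^ n
^-monoʳ-∣ p {m} {n} m≤n = divides (p ^ (n ∸ m)) (begin
    p ^ n                 ≡⟨ cong (p ^_) (sym (m+[n∸m]≡n m≤n)) ⟩
    p ^ (m + (n ∸ m))     ≡⟨ ^-distribˡ-+-* p m (n ∸ m) ⟩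
    p ^ m * p ^ (n ∸ m)   ≡⟨ *-comm (p ^ m) _ ⟩
    p ^ (n ∸ m) * p ^ m   ∎)
  where open ≡-Reasoning

m/o+n/o≤[m+n]/o : ∀ m n o .{{_ : NonZero o}} → m / o + n / o ≤ (m + n) / o
m/o+n/o≤[m+n]/o m n o = begin
    m / o + n / o               ≡⟨ m*n/n≡m (m / o + n / o) o ⟨
    (m / o + n / o) * o / o     ≤⟨ /-monoˡ-≤ o quotients*o≤m+n ⟩
    (m + n) / o                 ∎
  where
  open ≤-Reasoning
  quotients*o≤m+n : (m / o + n / o) * o ≤ m + n
  quotients*o≤m+n = begin
    (m / o + n / o) * o         ≡⟨ *-distribʳ-+ o (m / o) (n / o) ⟩
    m / o * o + n / o * o       ≤⟨ +-mono-≤ (m/n*n≤m m o) (m/n*n≤m n o) ⟩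
    m + n                       ∎

pred[m]+pred[n]≤pred[m*n] : ∀ {m n} → .{{NonZero m}} → .{{NonZero n}} →
                            pred m + pred n ≤ pred (m * n)
pred[m]+pred[n]≤pred[m*n] {suc m} {suc n} =
  subst (_≤ n + m * suc n) (+-comm n m) (+-monoʳ-≤ n (m≤m*n m (suc n)))

coprime-1ˡ : ∀ {n} → Coprime 1 n
coprime-1ˡ (d∣1 , _) = ∣1⇒≡1 d∣1

coprime-*ˡ : ∀ {m n a} → Coprime m a → Coprime n a → Coprime (m * n) a
coprime-*ˡ {m} {n} m⊥a n⊥a {d} (d∣mn , d∣a) =
  m⊥a (coprime-divisor d⊥n (subst (d ∣_) (*-comm m n) d∣mn) , d∣a)
  where
  d⊥n : Coprime d n
  d⊥n (e∣d , e∣n) = n⊥a (e∣n , ∣-trans e∣d d∣a)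

coprime-^ˡ : ∀ {m a} k → Coprime m a → Coprime (m ^ k) a
coprime-^ˡ zero    _   = coprime-1ˡ
coprime-^ˡ (suc k) m⊥a = coprime-*ˡ m⊥a (coprime-^ˡ k m⊥a)

coprime∧∣∧∣⇒*∣ : ∀ {m n c} → Coprime m n → m ∣ c → n ∣ c → m * n ∣ c
coprime∧∣∧∣⇒*∣ {m} {n} m⊥n m∣c (divides q refl) =
  *-monoˡ-∣ n (coprime-divisor m⊥n (subst (m ∣_) (*-comm q n) m∣c))

expo-mono-≤ : ∀ p {m n} → m ≤ n → expo m p ≤ expo n p
expo-mono-≤ zero          _   = z≤n
expo-mono-≤ (suc zero)    _   = z≤n
expo-mono-≤ (suc (suc k)) m≤n = /-monoˡ-≤ (suc k) m≤n

expo-superadditive : ∀ p m n → expo m p + expo n p ≤ expo (m + n) p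
expo-superadditive zero          _ _ = z≤n
expo-superadditive (suc zero)    _ _ = z≤n
expo-superadditive (suc (suc k)) m n = m/o+n/o≤[m+n]/o m n (suc k)

primeFactor-mono-∣ : ∀ p {m n} → m ≤ n → primeFactor m p ∣ primeFactor n p
primeFactor-mono-∣ p m≤n with prime? p
... | yes _ = ^-monoʳ-∣ p (expo-mono-≤ p m≤n)
... | no _  = ∣-refl

primeFactor-supermultiplicative : ∀ p m n →
  primeFactor m p * primeFactor n p ∣ primeFactor (m + n) p
primeFactor-supermultiplicative p m n with prime? p
... | yes _ = subst (_∣ p ^ expo (m + n) p) (^-distribˡ-+-* p (expo m p) (expo n p))
                (^-monoʳ-∣ p (expo-superadditive p m n))
... | no _  = ∣-refl

expo-pred-self : ∀ {p} → 2 ≤ p → expo (pred p) p ≡ 1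
expo-pred-self (s≤s (s≤s {n = k} _)) = n/n≡1 (suc k)

p∣primeFactor[p-1,p] : ∀ {p} → Prime p → p ∣ primeFactor (pred p) p
p∣primeFactor[p-1,p] {p} pr with prime? p
... | yes _  = subst (λ e → p ∣ p ^ e) (sym (expo-pred-self (prime⇒2≤ pr))) (m∣m*n 1)
... | no ¬pr = contradiction pr ¬pr

primeFactor-coprime : ∀ n q {p} → Prime p → suc q < p → Coprime (primeFactor n (suc q)) p
primeFactor-coprime n q pr 1+q<p with prime? (suc q)
... | yes _ = coprime-^ˡ (expo n (suc q)) (Coprimality.sym (prime⇒coprime pr 1+q<p))
... | no _  = coprime-1ˡ

primeProdUpTo-mono-∣ : ∀ N {m n} → m ≤ n → D m N ∣ D n N
primeProdUpTo-mono-∣ zero    _   = ∣-refl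
primeProdUpTo-mono-∣ (suc N) m≤n =
  *-pres-∣ (primeFactor-mono-∣ (suc N) m≤n) (primeProdUpTo-mono-∣ N m≤n)

primeProdUpTo-supermultiplicative : ∀ N m n → D m N * D n N ∣ D (m + n) N
primeProdUpTo-supermultiplicative zero    m n = ∣-refl
primeProdUpTo-supermultiplicative (suc N) m n =
  subst (_∣ D (m + n) (suc N)) (interchange (primeFactor m (suc N)) (primeFactor n (suc N)) (D m N) (D n N))
    (*-pres-∣ (primeFactor-supermultiplicative (suc N) m n) (primeProdUpTo-supermultiplicative N m n))

primeProdUpTo-coprime : ∀ n N {p} → Prime p → N < p → Coprime (D n N) p
primeProdUpTo-coprime n zero    pr _   = coprime-1ˡ
primeProdUpTo-coprime n (suc N) pr N<p =
  coprime-*ˡ (primeFactor-coprime n N pr N<p) (primeProdUpTo-coprime n N pr (≤-trans (n≤1+n (suc N)) N<p))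

prime∣primeProdUpTo : ∀ N {p} → Prime p → p ≤ N → p ∣ D (pred p) N
prime∣primeProdUpTo zero    pr p≤0 with () ← ≤-trans (prime⇒2≤ pr) p≤0
prime∣primeProdUpTo (suc N) {p} pr p≤N with p ≟ suc N
... | yes refl = ∣m⇒∣m*n (D (pred p) N) (p∣primeFactor[p-1,p] pr)
... | no p≢N   = ∣n⇒∣m*n (primeFactor (pred p) (suc N))
                   (prime∣primeProdUpTo N pr (s≤s⁻¹ (≤∧≢⇒< p≤N p≢N)))

∣primeProdUpTo-pred-* : ∀ N {m n} → .{{NonZero m}} → .{{NonZero n}} →
  m ∣ D (pred m) N → n ∣ D (pred n) N → m * n ∣ D (pred (m * n)) N
∣primeProdUpTo-pred-* N {m} {n} m∣ n∣ = begin
  m * n                         ∣⟨ *-pres-∣ m∣ n∣ ⟩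
  D (pred m) N * D (pred n) N   ∣⟨ primeProdUpTo-supermultiplicative N (pred m) (pred n) ⟩
  D (pred m + pred n) N         ∣⟨ primeProdUpTo-mono-∣ N pred[m]+pred[n]≤pred[m*n] ⟩
  D (pred (m * n)) N            ∎
  where open ∣-Reasoning

product∣primeProdUpTo : ∀ N {ps : List ℕ} → List.All Prime ps → product ps ≤ N →
                        product ps ∣ D (pred (product ps)) N
product∣primeProdUpTo N List.[] _ = 1∣ _
product∣primeProdUpTo N {p List.∷ ps} (pr List.∷ prs) p*ps≤N =
  ∣primeProdUpTo-pred-* N {{prime⇒nonZero pr}} {{productOfPrimes≢0 prs}}
    (prime∣primeProdUpTo N pr (≤-trans (m≤m*n p (product ps) {{productOfPrimes≢0 prs}}) p*ps≤N))
    (product∣primeProdUpTo N prs (≤-trans (m≤n*m (product ps) p {{prime⇒nonZero pr}}) p*ps≤N))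

∣primeProdUpTo-pred : ∀ N {x} → .{{NonZero x}} → x ≤ N → x ∣ D (pred x) N
∣primeProdUpTo-pred N {x} x≤N =
  subst (λ y → y ∣ D (pred y) N) (sym isFactorisation)
    (product∣primeProdUpTo N factorsPrime (subst (_≤ N) isFactorisation x≤N))
  where open PrimeFactorisation (factorise x)

vprod∣primeProdUpTo : ∀ N {m} (i : Vec ℕ m) → All (1 ≤_) i → sum (map pred i) < N →
                      vprod i ∣ D (sum (map pred i)) N
vprod∣primeProdUpTo N []          []              _       = 1∣ _
vprod∣primeProdUpTo N (suc x ∷ i) (s≤s z≤n ∷ i≥1) x+e<N =
  ∣-trans (*-pres-∣ (∣primeProdUpTo-pred N (≤-trans (s≤s (m≤m+n x e)) x+e<N))
                    (vprod∣primeProdUpTo N i i≥1 (≤-trans (s≤s (m≤n+m e x)) x+e<N)))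
          (primeProdUpTo-supermultiplicative N x e)
  where e = sum (map pred i)

sum-map-pred : ∀ {m} (i : Vec ℕ m) → All (1 ≤_) i → m + sum (map pred i) ≡ sum i
sum-map-pred []          []              = refl
sum-map-pred {suc m} (suc x ∷ i) (s≤s z≤n ∷ i≥1) =
  cong suc (trans (x∙yz≈y∙xz m x (sum (map pred i))) (cong (x +_) (sum-map-pred i i≥1)))

BoundedSumProduct : ℕ → ℕ → Set
BoundedSumProduct n m = ∃ λ (i : Vec ℕ n) → All (1 ≤_) i × sum i ≤ 2 * n × vprod i ≡ m

boundedSumProduct∣primeProdUpTo : ∀ {n N} → n < N → ∀ x → BoundedSumProduct n x → x ∣ D n N
boundedSumProduct∣primeProdUpTo {n} {N} n<N _ (i , i≥1 , Σi≤2n , refl) =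
  ∣-trans (vprod∣primeProdUpTo N i i≥1 (≤-<-trans e≤n n<N)) (primeProdUpTo-mono-∣ N e≤n)
  where
  e≤n : sum (map pred i) ≤ n
  e≤n = +-cancelˡ-≤ n _ _ (begin
    n + sum (map pred i)   ≡⟨ sum-map-pred i i≥1 ⟩
    sum i                  ≤⟨ Σi≤2n ⟩
    2 * n                  ≡⟨ cong (n +_) (+-identityʳ n) ⟩
    n + n                  ∎)
    where open ≤-Reasoning

powerVector : ∀ m → ℕ → ℕ → Vec ℕ m
powerVector zero    _       _ = []
powerVector (suc m) zero    p = 1 ∷ powerVector m zero p
powerVector (suc m) (suc k) p = p ∷ powerVector m k p

powerVector-positive : ∀ m k {p} → 1 ≤ p → All (1 ≤_) (powerVector m k p)
powerVector-positive zero    _       _   = []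
powerVector-positive (suc m) zero    p≥1 = s≤s z≤n ∷ powerVector-positive m zero p≥1
powerVector-positive (suc m) (suc k) p≥1 = p≥1 ∷ powerVector-positive m k p≥1

sum-powerVector : ∀ {m k} q → k ≤ m → sum (powerVector m k (suc q)) ≡ m + k * q
sum-powerVector {zero}  {zero}  q _         = refl
sum-powerVector {suc m} {zero}  q _         = cong suc (sum-powerVector {m} q z≤n)
sum-powerVector {suc m} {suc k} q (s≤s k≤m) =
  cong suc (trans (cong (q +_) (sum-powerVector q k≤m)) (x∙yz≈y∙xz q m (k * q)))

vprod-powerVector : ∀ {m k} p → k ≤ m → vprod (powerVector m k p) ≡ p ^ k
vprod-powerVector {zero}  {zero}  p _         = refl
vprod-powerVector {suc m} {zero}  p _         = cong (1 *_) (vprod-powerVector {m} p z≤n)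
vprod-powerVector {suc m} {suc k} p (s≤s k≤m) = cong (p *_) (vprod-powerVector p k≤m)

^expo-boundedSumProduct : ∀ n {p} → 2 ≤ p → BoundedSumProduct n (p ^ expo n p)
^expo-boundedSumProduct n {p} (s≤s (s≤s {n = q} _)) =
  powerVector n k p , powerVector-positive n k (s≤s z≤n) , Σ≤2n , vprod-powerVector p k≤n
  where
  k = n / suc q
  k≤n : k ≤ n
  k≤n = m/n≤m n (suc q)
  Σ≤2n : sum (powerVector n k p) ≤ 2 * n
  Σ≤2n = begin
    sum (powerVector n k p)   ≡⟨ sum-powerVector (suc q) k≤n ⟩
    n + k * suc q             ≤⟨ +-monoʳ-≤ n (m/n*n≤m n (suc q)) ⟩
    n + n                     ≡⟨ cong (n +_) (+-identityʳ n) ⟨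
    2 * n                     ∎
    where open ≤-Reasoning

primeProdUpTo-least : ∀ n N {c} → (∀ x → BoundedSumProduct n x → x ∣ c) → D n N ∣ c
primeProdUpTo-least n zero    _         = 1∣ _
primeProdUpTo-least n (suc N) {c} bounded∣c with prime? (suc N)
... | yes pr = coprime∧∣∧∣⇒*∣
                 (coprime-^ˡ (expo n (suc N)) (Coprimality.sym (primeProdUpTo-coprime n N pr ≤-refl)))
                 (bounded∣c _ (^expo-boundedSumProduct n (prime⇒2≤ pr)))
                 (primeProdUpTo-least n N bounded∣c)
... | no _   = subst (_∣ c) (sym (*-identityˡ (D n N))) (primeProdUpTo-least n N bounded∣c)

corollary2 : (n N : ℕ) → n + 1 ≤ N →
    IsLCMOf (λ m → ∃ λ (i : Vec ℕ n) → All (1 ≤_) i × sum i ≤ 2 * n × vprod i ≡ m)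
            (primeProdUpTo n N)
corollary2 n N n+1≤N =
  boundedSumProduct∣primeProdUpTo (subst (_≤ N) (+-comm n 1) n+1≤N) ,
  λ c → primeProdUpTo-least n N
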